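{- For positive integers $n$ and non-negative integers $T,E$, let $F_n[T,E]$ denote the number of sequences $(s_1,\dots,s_n)$ of non-negative integers such that $s_1\le s_2\le\cdots\le s_n$, $\sum_{i=1}^r s_i\ge\binom{r}{2}$ for all $1\le r<n$, $s_n=E$, and $\sum_{i=1}^n s_i=T$. Let $SCS(n)$ denote the number of self-complementary score sequences of length $n$. Then for all integers $m\ge 1$, $$SCS(2m)=\sum_{T=\binom{m}{2}}^{m(m-1)}\ \sum_{E=\lceil T/m\rceil}^{m-1} F_m[T,E],$$ and $$SCS(2m+1)=\sum_{T=\binom{m}{2}}^{m^2}\ \sum_{E=\lceil T/m\rceil}^{m} F_m[T,E].$$
   Context: A score sequence of length $n\ge1$ is a sequence $(s_1,\dots,s_n)$ of non-negative integers with $s_1\le\cdots\le s_n$ that is the sequence of out-degrees (scores) of some tournament (orientation of the complete graph) on $n$ vertices, listed in nondecreasing order; equivalently (Landau), $\sum_{i=1}^r s_i\ge\binom r2$ for $1\le r<n$ and $\sum_{i=1}^n s_i=\binom n2$. A score sequence of length $n$ is called self-complementary if $s_{n+1-i}=n-1-s_i$ for all $1\le i\le\lfloor n/2\rfloor$. -}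

module Defs where

open import Data.Nat using (ℕ; zero; suc; _+_; _*_; _∸_; _≤_; _≤?_; _≟_; _/_; _<_)
open import Data.Nat.Combinatorics using (_C_)
open import Data.Fin using (Fin; toℕ; opposite)
import Data.Fin.Properties as FinP
open import Data.List using (List; []; _∷_; [_]; map; concatMap; applyUpTo; upTo; take; filter; length)
open import Data.Nat.ListAction using (sum)
import Data.Vec
open import Data.List.Relation.Unary.All using (All; all?)
open import Data.List.Relation.Unary.Linked using (Linked; linked?)
open import Data.Vec using (Vec; lookup; last; toList)
open import Data.Empty using (⊥)
open import Data.Product using (_×_)
open import Relation.Binary.PropositionalEquality using (_≡_)
open import Relation.Nullary using (Dec; yes; no; ¬_)
open import Relation.Nullary.Decidable using (_×-dec_; _→-dec_)
open import Relation.Unary using (Pred; Decidable)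

-- the integers a, a+1, ..., b (empty if b < a)
range : ℕ → ℕ → List ℕ
range a b = applyUpTo (a +_) (suc b ∸ a)

Σ[_to_] : ℕ → ℕ → (ℕ → ℕ) → ℕ
Σ[ a to b ] f = sum (map f (range a b))

-- ⌈ T / m ⌉ for m ≥ 1 (value at m = 0 is irrelevant, set to 0)
⌈_/_⌉ : ℕ → ℕ → ℕ
⌈ T / zero ⌉ = 0
⌈ T / suc k ⌉ = (T + k) / suc k

Nondecreasing : ∀ {n} → Vec ℕ n → Set
Nondecreasing s = Linked _≤_ (toList s)

PrefixCondition : ∀ {n} → Vec ℕ n → Set
PrefixCondition {n} s = All (λ r → r C 2 ≤ sum (take r (toList s))) (range 1 (n ∸ 1))

LastIs : ∀ {n} → Vec ℕ n → ℕ → Set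
LastIs {zero} s E = ⊥
LastIs {suc k} s E = last s ≡ E

-- Score sequence of length n (Landau's characterisation)
IsScoreSequence : ∀ {n} → Vec ℕ n → Set
IsScoreSequence {n} s =
  Nondecreasing s × PrefixCondition s × sum (toList s) ≡ n C 2

-- self-complementary: s_{n+1-i} = n-1-s_i for 1 ≤ i ≤ ⌊n/2⌋
-- (0-indexed: for i < ⌊n/2⌋, s[n-1-i] = (n-1) - s[i])
SelfComplementary : ∀ {n} → Vec ℕ n → Set
SelfComplementary {n} s =
  (i : Fin n) → toℕ i < n / 2 → lookup s (opposite i) ≡ (n ∸ 1) ∸ lookup s i

IsF : (n T E : ℕ) → Vec ℕ n → Set
IsF n T E s = Nondecreasing s × PrefixCondition s × LastIs s E × sum (toList s) ≡ T

vecsUpTo : (n b : ℕ) → List (Vec ℕ n)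
vecsUpTo zero b = [ Data.Vec.[] ]
vecsUpTo (suc n) b = concatMap (λ x → map (x Data.Vec.∷_) (vecsUpTo n b)) (upTo (suc b))

nondecreasing? : ∀ {n} → Decidable (Nondecreasing {n})
nondecreasing? s = linked? _≤?_ (toList s)

prefix? : ∀ {n} → Decidable (PrefixCondition {n})
prefix? {n} s = all? (λ r → r C 2 ≤? sum (take r (toList s))) (range 1 (n ∸ 1))

lastIs? : ∀ {n} (s : Vec ℕ n) (E : ℕ) → Dec (LastIs s E)
lastIs? {zero} s E = no (λ ())
lastIs? {suc k} s E = last s ≟ E

isScoreSequence? : ∀ {n} → Decidable (IsScoreSequence {n})
isScoreSequence? {n} s = nondecreasing? s ×-dec prefix? s ×-dec (sum (toList s) ≟ n C 2)

selfComplementary? : ∀ {n} → Decidable (SelfComplementary {n})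
selfComplementary? {n} s =
  FinP.all? (λ i → (toℕ i Data.Nat.<? n / 2) →-dec (lookup s (opposite i) ≟ (n ∸ 1) ∸ lookup s i))

isF? : ∀ n T E → Decidable (IsF n T E)
isF? n T E s = nondecreasing? s ×-dec prefix? s ×-dec lastIs? s E ×-dec (sum (toList s) ≟ T)

-- Every entry of such a sequence is ≤ its total C(n,2), so enumerating
-- vectors with entries ≤ C(n,2) enumerates all candidates.
SCS : ℕ → ℕ
SCS n = length (filter (λ s → isScoreSequence? s ×-dec selfComplementary? s) (vecsUpTo n (n C 2)))

-- F_n[T,E]: every entry of a counted sequence is ≤ its total T.
F : ℕ → ℕ → ℕ → ℕ
F n T E = length (filter (isF? n T E) (vecsUpTo n T))

-- A self-complementary score sequence of length n = 2m + d (d ≤ 1) is determined by its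
-- first half a: it must be a, then d entries equal to m, then the complements n - 1 - aᵢ in
-- reverse order, the middle being forced by the total C(n,2). For a sequence of this shape
-- the prefix of length m + d + j sums to the prefix of length m - j of a plus d·m + j(n - 1),
-- so Landau's conditions past the middle follow from those on a. Hence the halves are exactly
-- the nondecreasing sequences with entries ≤ m - 1 + d satisfying Landau's inequalities for
-- every r ≤ m; grouping them by their total T and last entry E, which then lies between
-- ⌈T/m⌉ and m - 1 + d, gives the double sum of F_m[T,E].

module Submission where

open import Defs
open import Data.Empty using (⊥-elim)
open import Data.Fin using (Fin; toℕ; fromℕ<; opposite)
open import Data.Fin.Properties using (toℕ-fromℕ<; opposite-prop)
open import Data.List as List
  using (List; []; _∷_; [_]; _++_; map; reverse; replicate; take; drop; length; filter; upTo; applyUpTo; cartesianProductWith)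
open import Data.List.Membership.Propositional using (_∈_)
open import Data.List.Membership.Propositional.Properties
  using (∈-∃++; ∈-++⁻; ∈-++⁺ˡ; ∈-++⁺ʳ; ∈-filter⁺; ∈-filter⁻; ∈-upTo⁺; ∈-upTo⁻; ∈-cartesianProductWith⁺; ∈-cartesianProductWith⁻)
open import Data.List.Properties
  using (length-++; length-map; length-replicate; length-drop; length-reverse; length-take; unfold-reverse; map-++; reverse-++;
         take++drop≡id; ++-identityʳ; take-all; take-take; map-applyUpTo; filter-accept; filter-reject)
open import Data.List.Relation.Binary.Permutation.Propositional.Properties using (↭-reverse)
open import Data.List.Relation.Unary.All as All using (All; []; _∷_)
import Data.List.Relation.Unary.All.Properties as All
open import Data.List.Relation.Unary.AllPairs as AllPairs using (AllPairs; []; _∷_)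
import Data.List.Relation.Unary.AllPairs.Properties as AllPairs
open import Data.List.Relation.Unary.Any using (here; there)
open import Data.List.Relation.Unary.Linked using (Linked; []; [-]; _∷_)
open import Data.List.Relation.Unary.Linked.Properties using (AllPairs⇒Linked; Linked⇒AllPairs)
open import Data.List.Relation.Unary.Unique.Propositional using (Unique)
import Data.List.Relation.Unary.Unique.Propositional.Properties as Unique
open import Data.Nat using (ℕ; zero; suc; _+_; _*_; _∸_; _/_; _⊓_; _≤_; _<_; _≤?_; z≤n; s≤s; s≤s⁻¹)
open import Data.Nat.Combinatorics using (_C_; nCk+nC[k+1]≡[n+1]C[k+1]; nC1≡n)
open import Data.Nat.DivMod using (m<n*o⇒m/o<n; m/n≤m; m<n⇒m/n≡0; m*n/n≡m; +-distrib-/-∣ʳ)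
open import Data.Nat.Divisibility using (divides-refl)
open import Data.Nat.ListAction using (sum)
open import Data.Nat.ListAction.Properties using (sum-++; sum-↭)
open import Data.Nat.Properties
open import Algebra.Properties.CommutativeSemigroup +-commutativeSemigroup
  using () renaming (interchange to +-interchange)
open import Data.Nat.Tactic.RingSolver using (solve-∀)
open import Data.Product using (_×_; _,_; proj₁; proj₂)
open import Data.Sum using (inj₁; inj₂)
open import Data.Vec as Vec using (Vec; lookup; toList; last)
import Data.Vec.Properties as Vec
open import Data.Vec.Relation.Binary.Equality.Cast using (cast-is-id)
open import Function using (_∘_; id; flip)
open import Relation.Binary.PropositionalEquality
  using (_≡_; _≢_; refl; sym; trans; cong; cong₂; subst; subst₂; module ≡-Reasoning)
open import Relation.Nullary using (¬_; yes; no)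
open import Relation.Nullary.Decidable using (_×-dec_)
open import Relation.Unary using (Decidable)

m<n∸o⇒o+m<n : ∀ {m n} o → m < n ∸ o → o + m < n
m<n∸o⇒o+m<n {n = n}     zero    m< = m<
m<n∸o⇒o+m<n {n = suc n} (suc o) m< = s≤s (m<n∸o⇒o+m<n o m<)

∸-suc-< : ∀ {j n} → j < n → n ∸ suc j < n
∸-suc-< {j} {suc n} _ = s≤s (m∸n≤m n j)

∸-suc-involutive : ∀ {j m} → j < m → m ∸ suc (m ∸ suc j) ≡ j
∸-suc-involutive {j} {suc m} (s≤s j≤m) = m∸[m∸n]≡n j≤m

n≤1⇒n*n≡n : ∀ {n} → n ≤ 1 → n * n ≡ n
n≤1⇒n*n≡n z≤n       = refl
n≤1⇒n*n≡n (s≤s z≤n) = refl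

≤-complement⇒≤ : ∀ {x K N} → N ≤ suc (K + K) → x ≤ N ∸ x → x ≤ K
≤-complement⇒≤ {x} {K} {N} N≤ x≤ = half (≤-trans (m≤o∸n⇒m+n≤o x (≤-trans x≤ (m∸n≤m N x)) x≤) N≤)
  where
    half : ∀ {x K} → x + x ≤ suc (K + K) → x ≤ K
    half {zero}          _       = z≤n
    half {suc x} {zero}  (s≤s h) with () ← subst (_≤ 0) (+-suc x x) h
    half {suc x} {suc K} (s≤s h) = s≤s (half (s≤s⁻¹ (subst₂ _≤_ (+-suc x x) (cong suc (+-suc K K)) h)))

⌈/⌉-≤ : ∀ {k T E} → T ≤ suc k * E → ⌈ T / suc k ⌉ ≤ E
⌈/⌉-≤ {k} {T} {E} T≤ = s≤s⁻¹ (m<n*o⇒m/o<n (s≤s (begin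
  T + k          ≤⟨ +-monoˡ-≤ k T≤ ⟩
  suc k * E + k  ≡⟨ cong (_+ k) (*-comm (suc k) E) ⟩
  E * suc k + k  ≡⟨ +-comm (E * suc k) k ⟩
  k + E * suc k  ∎)))
  where open ≤-Reasoning

2*nC2+n≡n*n : ∀ n → 2 * (n C 2) + n ≡ n * n
2*nC2+n≡n*n zero    = refl
2*nC2+n≡n*n (suc n) = begin
  2 * (suc n C 2) + suc n       ≡⟨ cong (λ c → 2 * c + suc n) (sym (nCk+nC[k+1]≡[n+1]C[k+1] n 1)) ⟩
  2 * (n C 1 + n C 2) + suc n   ≡⟨ cong (λ c → 2 * (c + n C 2) + suc n) (nC1≡n n) ⟩
  2 * (n + n C 2) + suc n       ≡⟨ shuffle n (n C 2) ⟩
  (2 * (n C 2) + n) + (2 * n + 1) ≡⟨ cong (_+ (2 * n + 1)) (2*nC2+n≡n*n n) ⟩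
  n * n + (2 * n + 1)           ≡⟨ square-suc n ⟩
  suc n * suc n                 ∎
  where open ≡-Reasoning
        shuffle : ∀ n c → 2 * (n + c) + suc n ≡ (2 * c + n) + (2 * n + 1)
        shuffle = solve-∀
        square-suc : ∀ n → n * n + (2 * n + 1) ≡ suc n * suc n
        square-suc = solve-∀

-- Doubling both sides and adding x + 2j turns them into polynomials, via 2·C(y,2) + y = y²
-- and j·K + j = j·(p + j + d).
C2-split : ∀ {p j K d} → d * d ≡ d → suc K ≡ p + j + d →
           p C 2 + d * (p + j) + j * (p + j + K) ≡ (p + j + d + j) C 2
C2-split {p} {j} {K} {d} d²≡d sK≡ = *-cancelˡ-≡ _ _ 2 (+-cancelʳ-≡ (x + 2 * j) _ _ (begin
  2 * (p C 2 + d * (p + j) + j * (p + j + K)) + (x + 2 * j)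
    ≡⟨ expand (p C 2) p j K d ⟩
  (2 * (p C 2) + p) + (2 * d * (p + j) + 2 * j * (p + j) + 2 * j * suc K + 2 * j + d)
    ≡⟨ cong₂ (λ a b → a + (2 * d * (p + j) + 2 * j * (p + j) + 2 * j * b + 2 * j + d)) (2*nC2+n≡n*n p) sK≡ ⟩
  p * p + (2 * d * (p + j) + 2 * j * (p + j) + 2 * j * (p + j + d) + 2 * j + d)
    ≡⟨ cong (λ e → p * p + (2 * d * (p + j) + 2 * j * (p + j) + 2 * j * (p + j + d) + 2 * j + e)) (sym d²≡d) ⟩
  p * p + (2 * d * (p + j) + 2 * j * (p + j) + 2 * j * (p + j + d) + 2 * j + d * d)
    ≡⟨ collect p j d ⟩
  x * x + 2 * j
    ≡⟨ cong (_+ 2 * j) (sym (2*nC2+n≡n*n x)) ⟩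
  2 * (x C 2) + x + 2 * j
    ≡⟨ +-assoc (2 * (x C 2)) x (2 * j) ⟩
  2 * (x C 2) + (x + 2 * j) ∎))
  where
    open ≡-Reasoning
    x = p + j + d + j
    expand : ∀ c p j K d → 2 * (c + d * (p + j) + j * (p + j + K)) + (p + j + d + j + 2 * j)
           ≡ (2 * c + p) + (2 * d * (p + j) + 2 * j * (p + j) + 2 * j * suc K + 2 * j + d)
    expand = solve-∀
    collect : ∀ p j d → p * p + (2 * d * (p + j) + 2 * j * (p + j) + 2 * j * (p + j + d) + 2 * j + d * d)
            ≡ (p + j + d + j) * (p + j + d + j) + 2 * j
    collect = solve-∀

nth : List ℕ → ℕ → ℕ
nth []       _       = 0
nth (x ∷ xs) zero    = x
nth (x ∷ xs) (suc i) = nth xs i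

nth-++ˡ : ∀ xs {ys i} → i < length xs → nth (xs ++ ys) i ≡ nth xs i
nth-++ˡ (x ∷ xs) {i = zero}  _         = refl
nth-++ˡ (x ∷ xs) {i = suc i} (s≤s i<) = nth-++ˡ xs i<

nth-++ʳ : ∀ xs {ys} j → nth (xs ++ ys) (length xs + j) ≡ nth ys j
nth-++ʳ []       j = refl
nth-++ʳ (x ∷ xs) j = nth-++ʳ xs j

nth-++-++ʳ : ∀ xs cs {ys} j → nth (xs ++ (cs ++ ys)) (length xs + length cs + j) ≡ nth ys j
nth-++-++ʳ xs cs j = trans (cong (nth (xs ++ _)) (+-assoc (length xs) (length cs) j)) (trans (nth-++ʳ xs (length cs + j)) (nth-++ʳ cs j))

nth-map : ∀ f xs {i} → i < length xs → nth (map f xs) i ≡ f (nth xs i)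
nth-map f (x ∷ xs) {zero}  _         = refl
nth-map f (x ∷ xs) {suc i} (s≤s i<) = nth-map f xs i<

nth-take : ∀ r xs {i} → i < r → nth (take r xs) i ≡ nth xs i
nth-take (suc r) []       _         = refl
nth-take (suc r) (x ∷ xs) {zero}  _         = refl
nth-take (suc r) (x ∷ xs) {suc i} (s≤s i<r) = nth-take r xs i<r

nth-reverse : ∀ xs {i} → i < length xs → nth (reverse xs) i ≡ nth xs (length xs ∸ suc i)
nth-reverse (x ∷ xs) {i} i<
  rewrite unfold-reverse x xs with m<1+n⇒m<n∨m≡n i<
... | inj₁ i<len = begin
  nth (reverse xs ++ [ x ]) i      ≡⟨ nth-++ˡ (reverse xs) (subst (i <_) (sym (length-reverse xs)) i<len) ⟩
  nth (reverse xs) i               ≡⟨ nth-reverse xs i<len ⟩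
  nth xs (length xs ∸ suc i)       ≡⟨ cong (nth (x ∷ xs)) (sym (+-∸-assoc 1 i<len)) ⟩
  nth (x ∷ xs) (length xs ∸ i)     ∎
  where open ≡-Reasoning
... | inj₂ refl = begin
  nth (reverse xs ++ [ x ]) (length xs)               ≡⟨ cong (nth (reverse xs ++ [ x ])) (sym (trans (+-identityʳ _) (length-reverse xs))) ⟩
  nth (reverse xs ++ [ x ]) (length (reverse xs) + 0) ≡⟨ nth-++ʳ (reverse xs) 0 ⟩
  x                                                   ≡⟨ cong (nth (x ∷ xs)) (sym (n∸n≡0 (length xs))) ⟩
  nth (x ∷ xs) (length xs ∸ length xs)                ∎
  where open ≡-Reasoning

≡-by-nth : ∀ xs ys → length xs ≡ length ys → (∀ {i} → i < length xs → nth xs i ≡ nth ys i) → xs ≡ ys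
≡-by-nth []       []       _   _  = refl
≡-by-nth (x ∷ xs) (y ∷ ys) len eq =
  cong₂ _∷_ (eq (s≤s z≤n)) (≡-by-nth xs ys (suc-injective len) (λ i< → eq (s≤s i<)))

All-nth⁺ : ∀ {P : ℕ → Set} xs → (∀ {i} → i < length xs → P (nth xs i)) → All P xs
All-nth⁺ []       _ = []
All-nth⁺ (x ∷ xs) P = P (s≤s z≤n) ∷ All-nth⁺ xs (λ i< → P (s≤s i<))

nth-mono : ∀ {xs i j} → Linked _≤_ xs → i ≤ j → j < length xs → nth xs i ≤ nth xs j
nth-mono {j = zero}  _          z≤n       _         = ≤-refl
nth-mono {j = suc j} [-]        _         (s≤s ())
nth-mono {j = suc j} (x≤y ∷ ys) z≤n       (s≤s j<) = ≤-trans x≤y (nth-mono ys z≤n j<)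
nth-mono {j = suc j} (x≤y ∷ ys) (s≤s i≤j) (s≤s j<) = nth-mono ys i≤j j<

sum-reverse : ∀ xs → sum (reverse xs) ≡ sum xs
sum-reverse xs = sum-↭ (↭-reverse xs)

sum-replicate : ∀ d x → sum (replicate d x) ≡ d * x
sum-replicate zero    x = refl
sum-replicate (suc d) x = cong (x +_) (sum-replicate d x)

sum-map-∸ : ∀ {N} xs → All (_≤ N) xs → sum (map (N ∸_) xs) + sum xs ≡ length xs * N
sum-map-∸         []       []         = refl
sum-map-∸ {N} (x ∷ xs) (x≤N ∷ xs≤N) = begin
  (N ∸ x + sum (map (N ∸_) xs)) + (x + sum xs) ≡⟨ +-interchange (N ∸ x) _ x _ ⟩
  (N ∸ x + x) + (sum (map (N ∸_) xs) + sum xs) ≡⟨ cong₂ _+_ (m∸n+n≡m x≤N) (sum-map-∸ xs xs≤N) ⟩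
  N + length xs * N                            ∎
  where open ≡-Reasoning

All-≤-sum : ∀ xs → All (_≤ sum xs) xs
All-≤-sum []       = []
All-≤-sum (x ∷ xs) = m≤m+n x (sum xs) ∷ All.map (λ y≤ → ≤-trans y≤ (m≤n+m (sum xs) x)) (All-≤-sum xs)

sum-≤-length* : ∀ {b} xs → All (_≤ b) xs → sum xs ≤ length xs * b
sum-≤-length* []       []           = z≤n
sum-≤-length* (x ∷ xs) (x≤b ∷ xs≤b) = +-mono-≤ x≤b (sum-≤-length* xs xs≤b)

≡-replicate : ∀ {y} cs → length cs ≤ 1 → sum cs ≡ length cs * y → cs ≡ replicate (length cs) y
≡-replicate []           _        _ = refl
≡-replicate (c ∷ [])     _        e = cong [_] (trans (sym (+-identityʳ c)) (trans e (+-identityʳ _)))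
≡-replicate (c ∷ _ ∷ _) (s≤s ()) _

take-++-length : ∀ (xs : List ℕ) {ys} k → take (length xs + k) (xs ++ ys) ≡ xs ++ take k ys
take-++-length []       k = refl
take-++-length (x ∷ xs) k = cong (x ∷_) (take-++-length xs k)

take-++ˡ : ∀ {r} (xs : List ℕ) {ys} → r ≤ length xs → take r (xs ++ ys) ≡ take r xs
take-++ˡ {zero}  xs       _        = refl
take-++ˡ {suc r} (x ∷ xs) (s≤s r≤) = cong (x ∷_) (take-++ˡ xs r≤)

All-reverse⁺ : ∀ {P : ℕ → Set} {xs} → All P xs → All P (reverse xs)
All-reverse⁺ {xs = []}     []       = []
All-reverse⁺ {xs = x ∷ xs} (p ∷ ps) rewrite unfold-reverse x xs = All.++⁺ (All-reverse⁺ ps) (p ∷ [])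

AllPairs-reverse⁺ : ∀ {R : ℕ → ℕ → Set} {xs} → AllPairs R xs → AllPairs (flip R) (reverse xs)
AllPairs-reverse⁺ {xs = []}     []          = []
AllPairs-reverse⁺ {xs = x ∷ xs} (x~ ∷ xs!) rewrite unfold-reverse x xs =
  AllPairs.++⁺ (AllPairs-reverse⁺ xs!) ([] ∷ []) (All.map (_∷ []) (All-reverse⁺ x~))

Linked-take : ∀ r {xs} → Linked _≤_ xs → Linked _≤_ (take r xs)
Linked-take r = AllPairs⇒Linked ∘ AllPairs.take⁺ r ∘ Linked⇒AllPairs ≤-trans

Linked-replicate : ∀ d x → Linked _≤_ (replicate d x)
Linked-replicate zero          x = []
Linked-replicate (suc zero)    x = [-]
Linked-replicate (suc (suc d)) x = ≤-refl ∷ Linked-replicate (suc d) x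

Linked-++-≤ : ∀ {b xs ys} → Linked _≤_ xs → Linked _≤_ ys → All (_≤ b) xs → All (b ≤_) ys → Linked _≤_ (xs ++ ys)
Linked-++-≤ xs↑ ys↑ xs≤b b≤ys = AllPairs⇒Linked (AllPairs.++⁺ (Linked⇒AllPairs ≤-trans xs↑) (Linked⇒AllPairs ≤-trans ys↑)
  (All.map (λ x≤b → All.map (≤-trans x≤b) b≤ys) xs≤b))

lookup-toList : ∀ {n} (v : Vec ℕ n) (i : Fin n) → lookup v i ≡ nth (toList v) (toℕ i)
lookup-toList (x Vec.∷ v) Fin.zero    = refl
lookup-toList (x Vec.∷ v) (Fin.suc i) = lookup-toList v i

toList-take : ∀ m {n} (v : Vec ℕ (m + n)) → toList (Vec.take m v) ≡ take m (toList v)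
toList-take zero    v           = refl
toList-take (suc m) (x Vec.∷ v) = cong (x ∷_) (toList-take m v)

take-++ : ∀ {m n} (a : Vec ℕ m) (r : Vec ℕ n) → Vec.take m (a Vec.++ r) ≡ a
take-++ {m} a r = Vec.++-injectiveˡ (Vec.take m (a Vec.++ r)) a (Vec.take++drop≡id m (a Vec.++ r))

toList-injective : ∀ {n} (xs ys : Vec ℕ n) → toList xs ≡ toList ys → xs ≡ ys
toList-injective xs ys eq = trans (sym (cast-is-id refl xs)) (Vec.toList-injective refl xs ys eq)

All-≤-last : ∀ {k} (s : Vec ℕ (suc k)) → Nondecreasing s → All (_≤ last s) (toList s)
All-≤-last {zero}  (x Vec.∷ Vec.[])        _          = ≤-refl ∷ []
All-≤-last {suc k} (x Vec.∷ y Vec.∷ s) (x≤y ∷ ys) with All-≤-last (y Vec.∷ s) ys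
... | y≤ ∷ s≤ = ≤-trans x≤y y≤ ∷ y≤ ∷ s≤

All-last : ∀ {k} {P : ℕ → Set} (s : Vec ℕ (suc k)) → All P (toList s) → P (last s)
All-last {zero}  (x Vec.∷ Vec.[])    (Px ∷ []) = Px
All-last {suc k} (x Vec.∷ y Vec.∷ s) (_ ∷ Ps)  = All-last (y Vec.∷ s) Ps

mirror : ℕ → List ℕ → List ℕ
mirror N xs = reverse (map (N ∸_) xs)

length-mirror : ∀ N xs → length (mirror N xs) ≡ length xs
length-mirror N xs = trans (length-reverse (map (N ∸_) xs)) (length-map (N ∸_) xs)

nth-mirror : ∀ N xs {j} → j < length xs → nth (mirror N xs) j ≡ N ∸ nth xs (length xs ∸ suc j)
nth-mirror N xs {j} j< = begin
  nth (reverse (map (N ∸_) xs)) j                          ≡⟨ nth-reverse (map (N ∸_) xs) (subst (j <_) (sym (length-map _ xs)) j<) ⟩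
  nth (map (N ∸_) xs) (length (map (N ∸_) xs) ∸ suc j)     ≡⟨ cong (λ l → nth (map (N ∸_) xs) (l ∸ suc j)) (length-map _ xs) ⟩
  nth (map (N ∸_) xs) (length xs ∸ suc j)                  ≡⟨ nth-map (N ∸_) xs (∸-suc-< j<) ⟩
  N ∸ nth xs (length xs ∸ suc j)                           ∎
  where open ≡-Reasoning

sum-mirror : ∀ {N} xs → All (_≤ N) xs → sum (mirror N xs) + sum xs ≡ length xs * N
sum-mirror {N} xs xs≤N = trans (cong (_+ sum xs) (sum-reverse (map (N ∸_) xs))) (sum-map-∸ xs xs≤N)

Linked-mirror : ∀ {N xs} → Linked _≤_ xs → Linked _≤_ (mirror N xs)
Linked-mirror {N} = AllPairs⇒Linked ∘ AllPairs-reverse⁺ ∘ AllPairs.map⁺ ∘ AllPairs.map (∸-monoʳ-≤ N) ∘ Linked⇒AllPairs ≤-trans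

All-≤-mirror : ∀ {N K xs} → All (_≤ K) xs → All (N ∸ K ≤_) (mirror N xs)
All-≤-mirror {N} = All-reverse⁺ ∘ All.map⁺ ∘ All.map (∸-monoʳ-≤ N)

take-mirror : ∀ N xs {j} → j ≤ length xs → take j (mirror N xs) ≡ mirror N (drop (length xs ∸ j) xs)
take-mirror N xs {j} j≤ = begin
  take j (mirror N xs)                              ≡⟨ cong (take j ∘ mirror N) (take++drop≡id p xs) ⟨
  take j (mirror N (b ++ e))                        ≡⟨ cong (take j ∘ reverse) (map-++ (N ∸_) b e) ⟩
  take j (reverse (map (N ∸_) b ++ map (N ∸_) e))   ≡⟨ cong (take j) (reverse-++ (map (N ∸_) b) (map (N ∸_) e)) ⟩
  take j (mirror N e ++ mirror N b)                 ≡⟨ cong (λ i → take i (mirror N e ++ mirror N b)) length-e ⟨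
  take (length (mirror N e) + 0) (mirror N e ++ mirror N b) ≡⟨ take-++-length (mirror N e) 0 ⟩
  mirror N e ++ []                                  ≡⟨ ++-identityʳ (mirror N e) ⟩
  mirror N e                                        ∎
  where
    open ≡-Reasoning
    p = length xs ∸ j
    b = take p xs
    e = drop p xs
    length-e : length (mirror N e) + 0 ≡ j
    length-e = trans (+-identityʳ _) (trans (length-mirror N e) (trans (length-drop p xs) (m∸[m∸n]≡n j≤)))

prefixCondition⁺ : ∀ {n} (s : Vec ℕ n) → (∀ {r} → r < n → r C 2 ≤ sum (take r (toList s))) → PrefixCondition s
prefixCondition⁺ {n} s landau = All.applyUpTo⁺₁ (1 +_) (n ∸ 1) (λ r< → landau (m<n∸o⇒o+m<n 1 r<))

prefixCondition⁻ : ∀ {n} (s : Vec ℕ n) → PrefixCondition s → ∀ {r} → r < n → r C 2 ≤ sum (take r (toList s))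
prefixCondition⁻     s _  {zero}  _  = z≤n
prefixCondition⁻ {n} s pc {suc r} r< = All.applyUpTo⁻ (1 +_) (n ∸ 1) pc (∸-monoˡ-< r< (s≤s z≤n))

selfComplementary⁺ : ∀ {n} (v : Vec ℕ n) →
  (∀ {i} → i < n / 2 → nth (toList v) (n ∸ suc i) ≡ (n ∸ 1) ∸ nth (toList v) i) → SelfComplementary v
selfComplementary⁺ {n} v mirrored I I< = begin
  lookup v (opposite I)                  ≡⟨ lookup-toList v (opposite I) ⟩
  nth (toList v) (toℕ (opposite I))      ≡⟨ cong (nth (toList v)) (opposite-prop I) ⟩
  nth (toList v) (n ∸ suc (toℕ I))       ≡⟨ mirrored I< ⟩
  (n ∸ 1) ∸ nth (toList v) (toℕ I)       ≡⟨ cong ((n ∸ 1) ∸_) (lookup-toList v I) ⟨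
  (n ∸ 1) ∸ lookup v I                   ∎
  where open ≡-Reasoning

selfComplementary⁻ : ∀ {n} (v : Vec ℕ n) → SelfComplementary v →
  ∀ {i} → i < n / 2 → nth (toList v) (n ∸ suc i) ≡ (n ∸ 1) ∸ nth (toList v) i
selfComplementary⁻ {n} v sc {i} i< = begin
  nth (toList v) (n ∸ suc i)         ≡⟨ cong (λ t → nth (toList v) (n ∸ suc t)) (toℕ-fromℕ< i<n) ⟨
  nth (toList v) (n ∸ suc (toℕ I))   ≡⟨ cong (nth (toList v)) (opposite-prop I) ⟨
  nth (toList v) (toℕ (opposite I))  ≡⟨ lookup-toList v (opposite I) ⟨
  lookup v (opposite I)              ≡⟨ sc I (subst (_< n / 2) (sym (toℕ-fromℕ< i<n)) i<) ⟩
  (n ∸ 1) ∸ lookup v I               ≡⟨ cong ((n ∸ 1) ∸_) (trans (lookup-toList v I) (cong (nth (toList v)) (toℕ-fromℕ< i<n))) ⟩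
  (n ∸ 1) ∸ nth (toList v) i         ∎
  where
    open ≡-Reasoning
    i<n : i < n
    i<n = <-≤-trans i< (m/n≤m n 2)
    I : Fin n
    I = fromℕ< i<n

SatisfiesLandau : ∀ {m} → Vec ℕ m → Set
SatisfiesLandau {m} a = Nondecreasing a × PrefixCondition a × m C 2 ≤ sum (toList a)

satisfiesLandau? : ∀ {m} → Decidable (SatisfiesLandau {m})
satisfiesLandau? {m} a = nondecreasing? a ×-dec prefix? a ×-dec (m C 2 ≤? sum (toList a))

landau-≤ : ∀ {m} (a : Vec ℕ m) → SatisfiesLandau a → ∀ {r} → r ≤ m → r C 2 ≤ sum (take r (toList a))
landau-≤ {m} a (_ , pc , lb) {r} r≤m with m≤n⇒m<n∨m≡n r≤m
... | inj₁ r<m  = prefixCondition⁻ a pc r<m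
... | inj₂ refl = subst (λ l → r C 2 ≤ sum l) (sym (take-all r (toList a) (≤-reflexive (Vec.length-toList a)))) lb

-- Counting by bijection

count : ∀ {A : Set} {P : A → Set} → Decidable P → List A → ℕ
count P? xs = length (filter P? xs)

∈-++-skip : ∀ {A : Set} {v w : A} ys₁ {ys₂} → v ∈ ys₁ ++ w ∷ ys₂ → v ≢ w → v ∈ ys₁ ++ ys₂
∈-++-skip ys₁ v∈ v≢w with ∈-++⁻ ys₁ v∈
... | inj₁ v∈ys₁         = ∈-++⁺ˡ v∈ys₁
... | inj₂ (here v≡w)    = ⊥-elim (v≢w v≡w)
... | inj₂ (there v∈ys₂) = ∈-++⁺ʳ ys₁ v∈ys₂

length-≤-injection : ∀ {A B : Set} (f : A → B) {xs ys} → Unique xs →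
  (∀ {x} → x ∈ xs → f x ∈ ys) → (∀ {x y} → x ∈ xs → y ∈ xs → f x ≡ f y → x ≡ y) →
  length xs ≤ length ys
length-≤-injection f {[]}     _            _     _   = z≤n
length-≤-injection f {x ∷ xs} (x∉xs ∷ xs!) maps inj with ∈-∃++ (maps (here refl))
... | ys₁ , ys₂ , refl = begin
  suc (length xs)                 ≤⟨ s≤s (length-≤-injection f xs! maps′ (λ p q → inj (there p) (there q))) ⟩
  suc (length (ys₁ ++ ys₂))       ≡⟨ cong suc (length-++ ys₁) ⟩
  suc (length ys₁ + length ys₂)   ≡⟨ +-suc (length ys₁) (length ys₂) ⟨
  length ys₁ + length (f x ∷ ys₂) ≡⟨ length-++ ys₁ ⟨
  length (ys₁ ++ f x ∷ ys₂)       ∎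
  where
    open ≤-Reasoning
    maps′ : ∀ {z} → z ∈ xs → f z ∈ ys₁ ++ ys₂
    maps′ z∈ = ∈-++-skip ys₁ (maps (there z∈)) (λ fz≡fx → All.lookup x∉xs z∈ (inj (here refl) (there z∈) (sym fz≡fx)))

count-≤-retraction : ∀ {A B : Set} {P : A → Set} {Q : B → Set} (P? : Decidable P) (Q? : Decidable Q)
  {xs ys} (f : A → B) (g : B → A) → Unique xs →
  (∀ {x} → x ∈ xs → P x → f x ∈ ys × Q (f x) × g (f x) ≡ x) →
  count P? xs ≤ count Q? ys
count-≤-retraction P? Q? {xs} {ys} f g xs! hf = length-≤-injection f (Unique.filter⁺ P? xs!) maps inj
  where
    maps : ∀ {x} → x ∈ filter P? xs → f x ∈ filter Q? ys
    maps x∈ with x∈xs , Px ← ∈-filter⁻ P? x∈ with fx∈ , Qfx , _ ← hf x∈xs Px = ∈-filter⁺ Q? fx∈ Qfx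
    inj : ∀ {x y} → x ∈ filter P? xs → y ∈ filter P? xs → f x ≡ f y → x ≡ y
    inj x∈ y∈ fx≡fy with x∈xs , Px ← ∈-filter⁻ P? x∈ | y∈xs , Py ← ∈-filter⁻ P? y∈ =
      trans (sym (proj₂ (proj₂ (hf x∈xs Px)))) (trans (cong g fx≡fy) (proj₂ (proj₂ (hf y∈xs Py))))

count-bijection : ∀ {A B : Set} {P : A → Set} {Q : B → Set} (P? : Decidable P) (Q? : Decidable Q)
  {xs ys} (f : A → B) (g : B → A) → Unique xs → Unique ys →
  (∀ {x} → x ∈ xs → P x → f x ∈ ys × Q (f x) × g (f x) ≡ x) →
  (∀ {y} → y ∈ ys → Q y → g y ∈ xs × P (g y) × f (g y) ≡ y) →
  count P? xs ≡ count Q? ys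
count-bijection P? Q? f g xs! ys! hf hg =
  ≤-antisym (count-≤-retraction P? Q? f g xs! hf) (count-≤-retraction Q? P? g f ys! hg)

module _ {A : Set} {P : A → Set} (P? : Decidable P) where

  count-∷ : ∀ x xs → count P? (x ∷ xs) ≡ count P? [ x ] + count P? xs
  count-∷ x xs with P? x
  ... | yes _ = refl
  ... | no  _ = refl

  count-[-]-yes : ∀ {x} → P x → count P? [ x ] ≡ 1
  count-[-]-yes Px = cong length (filter-accept P? Px)

  count-[-]-no : ∀ {x} → ¬ P x → count P? [ x ] ≡ 0
  count-[-]-no ¬Px = cong length (filter-reject P? ¬Px)

concatMap-map≡cartesianProductWith : ∀ {A B C : Set} (f : A → B → C) xs ys →
  List.concatMap (λ x → map (f x) ys) xs ≡ cartesianProductWith f xs ys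
concatMap-map≡cartesianProductWith f []       ys = refl
concatMap-map≡cartesianProductWith f (x ∷ xs) ys = cong (map (f x) ys ++_) (concatMap-map≡cartesianProductWith f xs ys)

vecsUpTo-suc : ∀ n b → vecsUpTo (suc n) b ≡ cartesianProductWith Vec._∷_ (upTo (suc b)) (vecsUpTo n b)
vecsUpTo-suc n b = concatMap-map≡cartesianProductWith Vec._∷_ (upTo (suc b)) (vecsUpTo n b)

vecsUpTo-unique : ∀ n b → Unique (vecsUpTo n b)
vecsUpTo-unique zero    b = [] ∷ []
vecsUpTo-unique (suc n) b = subst Unique (sym (vecsUpTo-suc n b))
  (Unique.cartesianProductWith⁺ Vec._∷_ Vec.∷-injective (Unique.upTo⁺ (suc b)) (vecsUpTo-unique n b))

∈-vecsUpTo⁺ : ∀ {n b} (v : Vec ℕ n) → All (_≤ b) (toList v) → v ∈ vecsUpTo n b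
∈-vecsUpTo⁺         Vec.[]       []           = here refl
∈-vecsUpTo⁺ {suc n} {b} (x Vec.∷ v) (x≤b ∷ v≤b) = subst (x Vec.∷ v ∈_) (sym (vecsUpTo-suc n b))
  (∈-cartesianProductWith⁺ Vec._∷_ (∈-upTo⁺ (s≤s x≤b)) (∈-vecsUpTo⁺ v v≤b))

∈-vecsUpTo⁻ : ∀ {n b} (v : Vec ℕ n) → v ∈ vecsUpTo n b → All (_≤ b) (toList v)
∈-vecsUpTo⁻         Vec.[]       _  = []
∈-vecsUpTo⁻ {suc n} {b} (x Vec.∷ v) v∈
  with _ , _ , x∈ , v∈′ , refl ←
         ∈-cartesianProductWith⁻ Vec._∷_ (upTo (suc b)) (vecsUpTo n b) (subst (x Vec.∷ v ∈_) (vecsUpTo-suc n b) v∈)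
  = s≤s⁻¹ (∈-upTo⁻ x∈) ∷ ∈-vecsUpTo⁻ v v∈′

sum-applyUpTo-cong : ∀ {f g} c → (∀ {i} → i < c → f i ≡ g i) → sum (applyUpTo f c) ≡ sum (applyUpTo g c)
sum-applyUpTo-cong zero    _   = refl
sum-applyUpTo-cong (suc c) f≡g = cong₂ _+_ (f≡g (s≤s z≤n)) (sum-applyUpTo-cong c (λ i< → f≡g (s≤s i<)))

sum-applyUpTo-+ : ∀ f g c → sum (applyUpTo (λ i → f i + g i) c) ≡ sum (applyUpTo f c) + sum (applyUpTo g c)
sum-applyUpTo-+ f g zero    = refl
sum-applyUpTo-+ f g (suc c) = begin
  (f 0 + g 0) + sum (applyUpTo (λ i → f (suc i) + g (suc i)) c)
    ≡⟨ cong ((f 0 + g 0) +_) (sum-applyUpTo-+ (λ i → f (suc i)) (λ i → g (suc i)) c) ⟩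
  (f 0 + g 0) + (sum (applyUpTo (λ i → f (suc i)) c) + sum (applyUpTo (λ i → g (suc i)) c))
    ≡⟨ +-interchange (f 0) (g 0) _ _ ⟩
  (f 0 + sum (applyUpTo (λ i → f (suc i)) c)) + (g 0 + sum (applyUpTo (λ i → g (suc i)) c)) ∎
  where open ≡-Reasoning

sum-applyUpTo-zero : ∀ g c → (∀ i → g i ≡ 0) → sum (applyUpTo g c) ≡ 0
sum-applyUpTo-zero g zero    _    = refl
sum-applyUpTo-zero g (suc c) g≡0 = cong₂ _+_ (g≡0 0) (sum-applyUpTo-zero (λ i → g (suc i)) c (λ i → g≡0 (suc i)))

sum-applyUpTo-single : ∀ g {c j} → j < c → (∀ i → i ≢ j → g i ≡ 0) → sum (applyUpTo g c) ≡ g j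
sum-applyUpTo-single g {suc c} {zero}  _        g≡0 = begin
  g 0 + sum (applyUpTo (λ i → g (suc i)) c) ≡⟨ cong (g 0 +_) (sum-applyUpTo-zero _ c (λ i → g≡0 (suc i) (λ ()))) ⟩
  g 0 + 0                                   ≡⟨ +-identityʳ (g 0) ⟩
  g 0                                       ∎
  where open ≡-Reasoning
sum-applyUpTo-single g {suc c} {suc j} (s≤s j<c) g≡0 =
  cong₂ _+_ (g≡0 0 (λ ())) (sum-applyUpTo-single (λ i → g (suc i)) j<c (λ i i≢j → g≡0 (suc i) (i≢j ∘ suc-injective)))

Σ-as-applyUpTo : ∀ a b h → Σ[ a to b ] h ≡ sum (applyUpTo (λ i → h (a + i)) (suc b ∸ a))
Σ-as-applyUpTo a b h = cong sum (map-applyUpTo (a +_) h (suc b ∸ a))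

Σ-cong : ∀ {a b} f g → (∀ {T} → a ≤ T → T ≤ b → f T ≡ g T) → Σ[ a to b ] f ≡ Σ[ a to b ] g
Σ-cong {a} {b} f g f≡g = begin
  Σ[ a to b ] f                                          ≡⟨ Σ-as-applyUpTo a b f ⟩
  sum (applyUpTo (λ i → f (a + i)) (suc b ∸ a))          ≡⟨ sum-applyUpTo-cong (suc b ∸ a) (λ i< → f≡g (m≤m+n a _) (bound i<)) ⟩
  sum (applyUpTo (λ i → g (a + i)) (suc b ∸ a))          ≡⟨ Σ-as-applyUpTo a b g ⟨
  Σ[ a to b ] g                                          ∎
  where
    open ≡-Reasoning
    bound : ∀ {i} → i < suc b ∸ a → a + i ≤ b
    bound i< = s≤s⁻¹ (m<n∸o⇒o+m<n a i<)

Σ-+ : ∀ a b f g → Σ[ a to b ] (λ T → f T + g T) ≡ Σ[ a to b ] f + Σ[ a to b ] g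
Σ-+ a b f g = begin
  Σ[ a to b ] (λ T → f T + g T)                                  ≡⟨ Σ-as-applyUpTo a b _ ⟩
  sum (applyUpTo (λ i → f (a + i) + g (a + i)) (suc b ∸ a))      ≡⟨ sum-applyUpTo-+ _ _ (suc b ∸ a) ⟩
  sum (applyUpTo (λ i → f (a + i)) (suc b ∸ a)) + sum (applyUpTo (λ i → g (a + i)) (suc b ∸ a))
                                                                 ≡⟨ cong₂ _+_ (Σ-as-applyUpTo a b f) (Σ-as-applyUpTo a b g) ⟨
  Σ[ a to b ] f + Σ[ a to b ] g                                  ∎
  where open ≡-Reasoning

Σ-zero : ∀ a b h → (∀ {T} → a ≤ T → h T ≡ 0) → Σ[ a to b ] h ≡ 0
Σ-zero a b h h≡0 = trans (Σ-as-applyUpTo a b h) (sum-applyUpTo-zero _ (suc b ∸ a) (λ i → h≡0 (m≤m+n a i)))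

Σ-single : ∀ {a b t} h → a ≤ t → t ≤ b → (∀ T → T ≢ t → h T ≡ 0) → Σ[ a to b ] h ≡ h t
Σ-single {a} {b} {t} h a≤t t≤b h≡0 = begin
  Σ[ a to b ] h                                 ≡⟨ Σ-as-applyUpTo a b h ⟩
  sum (applyUpTo (λ i → h (a + i)) (suc b ∸ a)) ≡⟨ sum-applyUpTo-single _ (∸-monoˡ-< (s≤s t≤b) a≤t) off ⟩
  h (a + (t ∸ a))                               ≡⟨ cong h (m+[n∸m]≡n a≤t) ⟩
  h t                                           ∎
  where
    open ≡-Reasoning
    off : ∀ i → i ≢ t ∸ a → h (a + i) ≡ 0
    off i i≢ = h≡0 (a + i) (λ a+i≡t → i≢ (sym (trans (cong (_∸ a) (sym a+i≡t)) (m+n∸m≡n a i))))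

-- Grouping by total and last entry

F≡count : ∀ {k T E K} → E ≤ K → F (suc k) T E ≡ count (isF? (suc k) T E) (vecsUpTo (suc k) K)
F≡count {k} {T} {E} {K} E≤K = count-bijection (isF? (suc k) T E) (isF? (suc k) T E) id id
  (vecsUpTo-unique (suc k) T) (vecsUpTo-unique (suc k) K)
  (λ {s} _ Fs@(nd , _ , last≡E , _) →
    ∈-vecsUpTo⁺ s (All.map (λ x≤ → ≤-trans x≤ (≤-trans (≤-reflexive last≡E) E≤K)) (All-≤-last s nd)) , Fs , refl)
  (λ {s} _ Fs@(_ , _ , _ , sum≡T) → ∈-vecsUpTo⁺ s (subst (λ t → All (_≤ t) (toList s)) sum≡T (All-≤-sum (toList s))) , Fs , refl)

module _ (k K : ℕ) where

  private
    m = suc k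
    ΣΣ : (ℕ → ℕ → ℕ) → ℕ
    ΣΣ h = Σ[ m C 2 to m * K ] (λ T → Σ[ ⌈ T / m ⌉ to K ] (h T))

  ΣΣ-cong : ∀ h h′ → (∀ {T E} → E ≤ K → h T E ≡ h′ T E) → ΣΣ h ≡ ΣΣ h′
  ΣΣ-cong h h′ h≡ = Σ-cong {m C 2} {m * K} (λ T → Σ[ ⌈ T / m ⌉ to K ] (h T)) (λ T → Σ[ ⌈ T / m ⌉ to K ] (h′ T))
    (λ {T} _ _ → Σ-cong {⌈ T / m ⌉} (h T) (h′ T) (λ _ E≤K → h≡ E≤K))

  ΣΣ-+ : ∀ h h′ → ΣΣ (λ T E → h T E + h′ T E) ≡ ΣΣ h + ΣΣ h′
  ΣΣ-+ h h′ = trans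
    (Σ-cong {m C 2} {m * K} _ (λ T → Σ[ ⌈ T / m ⌉ to K ] (h T) + Σ[ ⌈ T / m ⌉ to K ] (h′ T))
      (λ {T} _ _ → Σ-+ ⌈ T / m ⌉ K (h T) (h′ T)))
    (Σ-+ (m C 2) (m * K) (λ T → Σ[ ⌈ T / m ⌉ to K ] (h T)) (λ T → Σ[ ⌈ T / m ⌉ to K ] (h′ T)))

  ΣΣ-count-[-] : (x : Vec ℕ m) → All (_≤ K) (toList x) →
    ΣΣ (λ T E → count (isF? m T E) [ x ]) ≡ count satisfiesLandau? [ x ]
  ΣΣ-count-[-] x x≤K with satisfiesLandau? x
  ... | yes (nd , pr , lb) = begin
    ΣΣ (λ T E → count (isF? m T E) [ x ])
      ≡⟨ Σ-single (λ T → Σ[ ⌈ T / m ⌉ to K ] (λ E → count (isF? m T E) [ x ])) lb sum≤mK off-T ⟩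
    Σ[ ⌈ sum (toList x) / m ⌉ to K ] (λ E → count (isF? m (sum (toList x)) E) [ x ])
      ≡⟨ Σ-single (λ E → count (isF? m (sum (toList x)) E) [ x ]) ⌈sum/m⌉≤last (All-last x x≤K) off-E ⟩
    count (isF? m (sum (toList x)) (last x)) [ x ]
      ≡⟨ count-[-]-yes (isF? m _ _) {x} (nd , pr , refl , refl) ⟩
    1
      ≡⟨ count-[-]-yes satisfiesLandau? (nd , pr , lb) ⟨
    count satisfiesLandau? [ x ] ∎
    where
      open ≡-Reasoning
      sum≤ : ∀ {b} → All (_≤ b) (toList x) → sum (toList x) ≤ m * b
      sum≤ {b} x≤b = subst (λ l → sum (toList x) ≤ l * b) (Vec.length-toList x) (sum-≤-length* (toList x) x≤b)
      sum≤mK : sum (toList x) ≤ m * K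
      sum≤mK = sum≤ x≤K
      ⌈sum/m⌉≤last : ⌈ sum (toList x) / m ⌉ ≤ last x
      ⌈sum/m⌉≤last = ⌈/⌉-≤ {k} (sum≤ (All-≤-last x nd))
      off-E : ∀ E → E ≢ last x → count (isF? m (sum (toList x)) E) [ x ] ≡ 0
      off-E E E≢ = count-[-]-no (isF? m _ E) {x} (λ (_ , _ , last≡E , _) → E≢ (sym last≡E))
      off-T : ∀ T → T ≢ sum (toList x) → Σ[ ⌈ T / m ⌉ to K ] (λ E → count (isF? m T E) [ x ]) ≡ 0
      off-T T T≢ = Σ-zero ⌈ T / m ⌉ K (λ E → count (isF? m T E) [ x ])
        (λ {E} _ → count-[-]-no (isF? m T E) {x} (λ (_ , _ , _ , sum≡T) → T≢ (sym sum≡T)))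
  ... | no ¬L = trans
    (Σ-zero (m C 2) (m * K) (λ T → Σ[ ⌈ T / m ⌉ to K ] (λ E → count (isF? m T E) [ x ]))
      (λ {T} C≤T → Σ-zero ⌈ T / m ⌉ K (λ E → count (isF? m T E) [ x ]) (λ {E} _ →
      count-[-]-no (isF? m T E) {x} (λ (nd , pr , _ , sum≡T) → ¬L (nd , pr , subst (m C 2 ≤_) (sym sum≡T) C≤T)))))
    (sym (count-[-]-no satisfiesLandau? ¬L))

  ΣΣ-count : ∀ V → All (λ x → All (_≤ K) (toList x)) V →
    ΣΣ (λ T E → count (isF? m T E) V) ≡ count satisfiesLandau? V
  ΣΣ-count []       []             =
    Σ-zero (m C 2) (m * K) (λ T → Σ[ ⌈ T / m ⌉ to K ] (λ _ → 0)) (λ {T} _ → Σ-zero ⌈ T / m ⌉ K _ (λ _ → refl))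
  ΣΣ-count (x ∷ V) (x≤K ∷ V≤K) = begin
    ΣΣ (λ T E → count (isF? m T E) (x ∷ V))
      ≡⟨ ΣΣ-cong _ _ (λ {T} {E} _ → count-∷ (isF? m T E) x V) ⟩
    ΣΣ (λ T E → count (isF? m T E) [ x ] + count (isF? m T E) V)
      ≡⟨ ΣΣ-+ (λ T E → count (isF? m T E) [ x ]) (λ T E → count (isF? m T E) V) ⟩
    ΣΣ (λ T E → count (isF? m T E) [ x ]) + ΣΣ (λ T E → count (isF? m T E) V)
      ≡⟨ cong₂ _+_ (ΣΣ-count-[-] x x≤K) (ΣΣ-count V V≤K) ⟩
    count satisfiesLandau? [ x ] + count satisfiesLandau? V
      ≡⟨ count-∷ satisfiesLandau? x V ⟨
    count satisfiesLandau? (x ∷ V) ∎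
    where open ≡-Reasoning

  ΣΣF≡count-satisfiesLandau : ΣΣ (F m) ≡ count satisfiesLandau? (vecsUpTo m K)
  ΣΣF≡count-satisfiesLandau = begin
    ΣΣ (F m)                                          ≡⟨ ΣΣ-cong _ _ (λ {T} E≤K → F≡count {k} {T} E≤K) ⟩
    ΣΣ (λ T E → count (isF? m T E) (vecsUpTo m K))   ≡⟨ ΣΣ-count (vecsUpTo m K) (All.tabulate (λ {x} x∈ → ∈-vecsUpTo⁻ x x∈)) ⟩
    count satisfiesLandau? (vecsUpTo m K)             ∎
    where open ≡-Reasoning

-- Halves of self-complementary score sequences

module Halves (k d : ℕ) (d≤1 : d ≤ 1) where

  -- n = 2m + d is the length, N = n - 1 the top score, K = m - 1 + d the top entry of a half.
  m K N n : ℕ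
  m = suc k
  K = k + d
  N = m + K
  n = m + (d + m)

  n∸1≡N : n ∸ 1 ≡ N
  n∸1≡N = reorder k d
    where reorder : ∀ k d → k + (d + suc k) ≡ suc k + (k + d)
          reorder = solve-∀

  n/2≡m : n / 2 ≡ m
  n/2≡m = begin
    n / 2              ≡⟨ cong (_/ 2) (reorder m d) ⟩
    (d + m * 2) / 2    ≡⟨ +-distrib-/-∣ʳ d (divides-refl m) ⟩
    d / 2 + m * 2 / 2  ≡⟨ cong₂ _+_ (m<n⇒m/n≡0 (s≤s d≤1)) (m*n/n≡m m 2) ⟩
    m                  ∎
    where open ≡-Reasoning
          reorder : ∀ m d → m + (d + m) ≡ d + m * 2
          reorder = solve-∀

  n∸suc≡ : ∀ {i} → i < m → n ∸ suc i ≡ m + d + (m ∸ suc i)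
  n∸suc≡ {i} i<m = begin
    m + (d + m) ∸ suc i        ≡⟨ cong (_∸ suc i) (reorder m d) ⟩
    m + d + m ∸ suc i          ≡⟨ +-∸-assoc (m + d) i<m ⟩
    m + d + (m ∸ suc i)        ∎
    where open ≡-Reasoning
          reorder : ∀ m d → m + (d + m) ≡ m + d + m
          reorder = solve-∀

  m<n : m < n
  m<n = m<m+n m (<-≤-trans (s≤s z≤n) (m≤n+m m d))

  K≤m : K ≤ m
  K≤m = subst (k + d ≤_) (+-comm k 1) (+-monoʳ-≤ k d≤1)

  K≤N : K ≤ N
  K≤N = m≤n+m K m

  All-≤K⇒≤N : ∀ {xs} → All (_≤ K) xs → All (_≤ N) xs
  All-≤K⇒≤N = All.map (λ x≤K → ≤-trans x≤K K≤N)

  N≤2K+1 : N ≤ suc (K + K)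
  N≤2K+1 = s≤s (+-monoˡ-≤ K (m≤m+n k d))

  -- Landau's bound at m + d + j in terms of the bound at p = m - j: the longer prefix also
  -- contains the d middle scores m and j complements, each pairing with an entry to sum N.
  landau-shift : ∀ {p j} → p + j ≡ m → p C 2 + d * m + j * N ≡ (m + d + j) C 2
  landau-shift {p} {j} p+j≡m = subst (λ x → p C 2 + d * x + j * (x + K) ≡ (x + d + j) C 2) p+j≡m
    (C2-split {p} {j} (n≤1⇒n*n≡n d≤1) (cong (_+ d) (sym p+j≡m)))

  nC2≡ : n C 2 ≡ d * m + m * N
  nC2≡ = trans (cong (_C 2) (sym (+-assoc m d m))) (sym (landau-shift {0} (+-identityˡ m)))

  double : Vec ℕ m → Vec ℕ n
  double a = a Vec.++ (Vec.replicate d m Vec.++ Vec.reverse (Vec.map (N ∸_) a))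

  half : Vec ℕ n → Vec ℕ m
  half = Vec.take m

  toList-double : ∀ a → toList (double a) ≡ toList a ++ (replicate d m ++ mirror N (toList a))
  toList-double a = begin
    toList (double a)
      ≡⟨ Vec.toList-++ a _ ⟩
    toList a ++ toList (Vec.replicate d m Vec.++ Vec.reverse (Vec.map (N ∸_) a))
      ≡⟨ cong (toList a ++_) (Vec.toList-++ (Vec.replicate d m) _) ⟩
    toList a ++ (toList (Vec.replicate d m) ++ toList (Vec.reverse (Vec.map (N ∸_) a)))
      ≡⟨ cong (λ r → toList a ++ (toList (Vec.replicate d m) ++ r)) (Vec.toList-reverse (Vec.map (N ∸_) a)) ⟩
    toList a ++ (toList (Vec.replicate d m) ++ reverse (toList (Vec.map (N ∸_) a)))
      ≡⟨ cong₂ (λ c r → toList a ++ (c ++ reverse r)) (Vec.toList-replicate d m) (Vec.toList-map (N ∸_) a) ⟩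
    toList a ++ (replicate d m ++ mirror N (toList a)) ∎
    where open ≡-Reasoning

  half-double : ∀ a → half (double a) ≡ a
  half-double a = take-++ a _

  sum-layout : ∀ xs cs → length xs ≡ m → All (_≤ N) xs → sum (xs ++ (cs ++ mirror N xs)) ≡ sum cs + m * N
  sum-layout xs cs len xs≤N = begin
    sum (xs ++ (cs ++ mirror N xs))          ≡⟨ trans (sum-++ xs _) (cong (sum xs +_) (sum-++ cs _)) ⟩
    sum xs + (sum cs + sum (mirror N xs))    ≡⟨ reorder (sum xs) (sum cs) _ ⟩
    sum cs + (sum (mirror N xs) + sum xs)    ≡⟨ cong (sum cs +_) (sum-mirror xs xs≤N) ⟩
    sum cs + length xs * N                   ≡⟨ cong (λ l → sum cs + l * N) len ⟩
    sum cs + m * N                           ∎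
    where open ≡-Reasoning
          reorder : ∀ a c y → a + (c + y) ≡ c + (y + a)
          reorder = solve-∀

  nth-mirror-half : ∀ xs cs ys → length xs ≡ m → length cs ≡ d → ∀ {i} → i < m →
    nth (xs ++ (cs ++ ys)) (n ∸ suc i) ≡ nth ys (m ∸ suc i)
  nth-mirror-half xs cs ys lx lc {i} i<m = trans
    (cong (nth (xs ++ (cs ++ ys))) (trans (n∸suc≡ i<m) (cong₂ (λ a b → a + b + (m ∸ suc i)) (sym lx) (sym lc))))
    (nth-++-++ʳ xs cs (m ∸ suc i))

  take-past-middle : ∀ xs → length xs ≡ m → ∀ {j} → j ≤ m →
    take (m + d + j) (xs ++ (replicate d m ++ mirror N xs)) ≡ xs ++ (replicate d m ++ mirror N (drop (m ∸ j) xs))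
  take-past-middle xs len {j} j≤m = begin
    take (m + d + j) L
      ≡⟨ cong (λ i → take i L) (trans (+-assoc m d j) (cong₂ (λ a c → a + (c + j)) (sym len) (sym (length-replicate d)))) ⟩
    take (length xs + (length (replicate d m) + j)) L
      ≡⟨ take-++-length xs _ ⟩
    xs ++ take (length (replicate d m) + j) (replicate d m ++ mirror N xs)
      ≡⟨ cong (xs ++_) (take-++-length (replicate d m) j) ⟩
    xs ++ (replicate d m ++ take j (mirror N xs))
      ≡⟨ cong (λ t → xs ++ (replicate d m ++ t)) (take-mirror N xs (subst (j ≤_) (sym len) j≤m)) ⟩
    xs ++ (replicate d m ++ mirror N (drop (length xs ∸ j) xs))
      ≡⟨ cong (λ l → xs ++ (replicate d m ++ mirror N (drop (l ∸ j) xs))) len ⟩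
    xs ++ (replicate d m ++ mirror N (drop (m ∸ j) xs)) ∎
    where
      open ≡-Reasoning
      L = xs ++ (replicate d m ++ mirror N xs)

  sum-take-past-middle : ∀ xs → length xs ≡ m → All (_≤ N) xs → ∀ {j} → j ≤ m →
    sum (take (m + d + j) (xs ++ (replicate d m ++ mirror N xs))) ≡ sum (take (m ∸ j) xs) + d * m + j * N
  sum-take-past-middle xs len xs≤N {j} j≤m = begin
    sum (take (m + d + j) (xs ++ (replicate d m ++ mirror N xs)))
      ≡⟨ cong sum (take-past-middle xs len j≤m) ⟩
    sum (xs ++ (replicate d m ++ mirror N e))
      ≡⟨ trans (sum-++ xs _) (cong (sum xs +_) (trans (sum-++ (replicate d m) _) (cong (_+ sum (mirror N e)) (sum-replicate d m)))) ⟩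
    sum xs + (d * m + sum (mirror N e))
      ≡⟨ cong (_+ (d * m + sum (mirror N e))) (trans (cong sum (sym (take++drop≡id p xs))) (sum-++ b e)) ⟩
    (sum b + sum e) + (d * m + sum (mirror N e))
      ≡⟨ reorder (sum b) (sum e) (d * m) (sum (mirror N e)) ⟩
    sum b + d * m + (sum (mirror N e) + sum e)
      ≡⟨ cong (sum b + d * m +_) (trans (sum-mirror e (All.drop⁺ p xs≤N)) (cong (_* N) length-e)) ⟩
    sum b + d * m + j * N ∎
    where
      open ≡-Reasoning
      p = m ∸ j
      b = take p xs
      e = drop p xs
      length-e : length e ≡ j
      length-e = trans (length-drop p xs) (trans (cong (_∸ p) len) (m∸[m∸n]≡n j≤m))
      reorder : ∀ b e c y → (b + e) + (c + y) ≡ b + c + (y + e)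
      reorder = solve-∀

  double-nondecreasing : ∀ a → Nondecreasing a → All (_≤ K) (toList a) → Nondecreasing (double a)
  double-nondecreasing a a↑ a≤K = subst (Linked _≤_) (sym (toList-double a))
    (Linked-++-≤ a↑ (Linked-++-≤ (Linked-replicate d m) (Linked-mirror a↑) (All.replicate⁺ d ≤-refl) m≤mirror)
      (All.map (λ x≤K → ≤-trans x≤K K≤m) a≤K) (All.++⁺ (All.replicate⁺ d ≤-refl) m≤mirror))
    where
      m≤mirror : All (m ≤_) (mirror N (toList a))
      m≤mirror = subst (λ l → All (l ≤_) (mirror N (toList a))) (m+n∸n≡m m K) (All-≤-mirror a≤K)

  double-sum : ∀ a → All (_≤ K) (toList a) → sum (toList (double a)) ≡ n C 2
  double-sum a a≤K = begin
    sum (toList (double a))                                       ≡⟨ cong sum (toList-double a) ⟩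
    sum (toList a ++ (replicate d m ++ mirror N (toList a)))      ≡⟨ sum-layout (toList a) _ (Vec.length-toList a) (All-≤K⇒≤N a≤K) ⟩
    sum (replicate d m) + m * N                                   ≡⟨ cong (_+ m * N) (sum-replicate d m) ⟩
    d * m + m * N                                                 ≡⟨ nC2≡ ⟨
    n C 2                                                         ∎
    where open ≡-Reasoning

  double-landau : ∀ a → SatisfiesLandau a → All (_≤ K) (toList a) → ∀ {r} → r < n → r C 2 ≤ sum (take r (toList (double a)))
  double-landau a landau a≤K {r} r<n rewrite toList-double a with r ≤? m
  ... | yes r≤m = subst (λ l → r C 2 ≤ sum l) (sym (take-++ˡ (toList a) (subst (r ≤_) (sym len) r≤m))) (landau-≤ a landau r≤m)
    where len = Vec.length-toList a
  ... | no r≰m = subst (λ i → i C 2 ≤ sum (take i (toList a ++ (replicate d m ++ mirror N (toList a))))) (sym r≡) (begin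
    (m + d + j) C 2                                ≡⟨ landau-shift (m∸n+n≡m j≤m) ⟨
    (m ∸ j) C 2 + d * m + j * N                    ≤⟨ +-monoˡ-≤ (j * N) (+-monoˡ-≤ (d * m) (landau-≤ a landau (m∸n≤m m j))) ⟩
    sum (take (m ∸ j) (toList a)) + d * m + j * N  ≡⟨ sum-take-past-middle (toList a) (Vec.length-toList a) (All-≤K⇒≤N a≤K) j≤m ⟨
    sum (take (m + d + j) (toList a ++ (replicate d m ++ mirror N (toList a)))) ∎)
    where
      open ≤-Reasoning
      m+d≤r : m + d ≤ r
      m+d≤r = ≤-trans (+-monoʳ-≤ m d≤1) (subst (_≤ r) (+-comm 1 m) (≰⇒> r≰m))
      j = r ∸ (m + d)
      r≡ : r ≡ m + d + j
      r≡ = sym (m+[n∸m]≡n m+d≤r)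
      j≤m : j ≤ m
      j≤m = <⇒≤ (+-cancelˡ-< (m + d) j m (subst₂ _<_ r≡ (sym (+-assoc m d m)) r<n))

  double-selfComplementary : ∀ a → SelfComplementary (double a)
  double-selfComplementary a = selfComplementary⁺ (double a) mirrored
    where
      La = toList a
      len = Vec.length-toList a
      mirrored : ∀ {i} → i < n / 2 → nth (toList (double a)) (n ∸ suc i) ≡ (n ∸ 1) ∸ nth (toList (double a)) i
      mirrored {i} i< rewrite toList-double a = begin
        nth (La ++ (replicate d m ++ mirror N La)) (n ∸ suc i)
                                                               ≡⟨ nth-mirror-half La (replicate d m) (mirror N La) len (length-replicate d) i<m ⟩
        nth (mirror N La) (m ∸ suc i)                          ≡⟨ nth-mirror N La (subst (m ∸ suc i <_) (sym len) (∸-suc-< i<m)) ⟩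
        N ∸ nth La (length La ∸ suc (m ∸ suc i))               ≡⟨ cong (λ l → N ∸ nth La (l ∸ suc (m ∸ suc i))) len ⟩
        N ∸ nth La (m ∸ suc (m ∸ suc i))                       ≡⟨ cong (λ t → N ∸ nth La t) (∸-suc-involutive i<m) ⟩
        N ∸ nth La i                                           ≡⟨ cong₂ _∸_ (sym n∸1≡N) (sym (nth-++ˡ La (subst (i <_) (sym len) i<m))) ⟩
        (n ∸ 1) ∸ nth (La ++ (replicate d m ++ mirror N La)) i ∎
        where
          open ≡-Reasoning
          i<m : i < m
          i<m = subst (i <_) n/2≡m i<

  double-isScoreSequence : ∀ a → SatisfiesLandau a → All (_≤ K) (toList a) → IsScoreSequence (double a)
  double-isScoreSequence a landau a≤K =
    double-nondecreasing a (proj₁ landau) a≤K , prefixCondition⁺ (double a) (double-landau a landau a≤K) , double-sum a a≤K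

  half-≤K : ∀ v → Nondecreasing v → SelfComplementary v → All (_≤ K) (toList (half v))
  half-≤K v v↑ sc = subst (All (_≤ K)) (sym (toList-take m v)) (All-nth⁺ (take m Lv) bound)
    where
      Lv = toList v
      bound : ∀ {i} → i < length (take m Lv) → nth (take m Lv) i ≤ K
      bound {i} i< = subst (_≤ K) (sym (nth-take m Lv i<m)) (≤-complement⇒≤ N≤2K+1 (begin
        nth Lv i             ≤⟨ nth-mono v↑ i≤far far<n ⟩
        nth Lv (n ∸ suc i)   ≡⟨ selfComplementary⁻ v sc (subst (i <_) (sym n/2≡m) i<m) ⟩
        (n ∸ 1) ∸ nth Lv i   ≡⟨ cong (_∸ nth Lv i) n∸1≡N ⟩
        N ∸ nth Lv i         ∎))
        where
          open ≤-Reasoning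
          i<m : i < m
          i<m = <-≤-trans i< (≤-trans (≤-reflexive (length-take m Lv)) (m⊓n≤m m _))
          i≤far : i ≤ n ∸ suc i
          i≤far = subst (i ≤_) (sym (n∸suc≡ i<m)) (≤-trans (<⇒≤ i<m) (≤-trans (m≤m+n m d) (m≤m+n (m + d) _)))
          far<n : n ∸ suc i < length Lv
          far<n = subst (n ∸ suc i <_) (sym (Vec.length-toList v)) (∸-suc-< (<-trans i<m m<n))

  half-satisfiesLandau : ∀ v → IsScoreSequence v → SatisfiesLandau (half v)
  half-satisfiesLandau v (v↑ , pc , _) =
    subst (Linked _≤_) (sym (toList-take m v)) (Linked-take m v↑) ,
    prefixCondition⁺ (half v) landau ,
    subst (λ l → m C 2 ≤ sum l) (sym (toList-take m v)) (prefixCondition⁻ v pc m<n)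
    where
      take-half : ∀ {r} → r ≤ m → take r (toList (half v)) ≡ take r (toList v)
      take-half {r} r≤m = begin
        take r (toList (half v))      ≡⟨ cong (take r) (toList-take m v) ⟩
        take r (take m (toList v))    ≡⟨ take-take r m (toList v) ⟩
        take (r ⊓ m) (toList v)       ≡⟨ cong (λ i → take i (toList v)) (m≤n⇒m⊓n≡m r≤m) ⟩
        take r (toList v)             ∎
        where open ≡-Reasoning
      landau : ∀ {r} → r < m → r C 2 ≤ sum (take r (toList (half v)))
      landau {r} r<m = subst (λ l → r C 2 ≤ sum l) (sym (take-half (<⇒≤ r<m))) (prefixCondition⁻ v pc (<-trans r<m m<n))

  suffix≡mirror : ∀ xs cs ys → length xs ≡ m → length cs ≡ d → length ys ≡ m →
    (∀ {i} → i < m → nth (xs ++ (cs ++ ys)) (n ∸ suc i) ≡ N ∸ nth xs i) → ys ≡ mirror N xs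
  suffix≡mirror xs cs ys lx lc ly mirrored = ≡-by-nth ys (mirror N xs) (trans ly (sym (trans (length-mirror N xs) lx))) at
    where
      at : ∀ {j} → j < length ys → nth ys j ≡ nth (mirror N xs) j
      at {j} j< = begin
        nth ys j                                ≡⟨ cong (nth ys) (∸-suc-involutive j<m) ⟨
        nth ys (m ∸ suc i)                      ≡⟨ nth-mirror-half xs cs ys lx lc i<m ⟨
        nth (xs ++ (cs ++ ys)) (n ∸ suc i)      ≡⟨ mirrored i<m ⟩
        N ∸ nth xs i                            ≡⟨ cong (λ l → N ∸ nth xs (l ∸ suc j)) lx ⟨
        N ∸ nth xs (length xs ∸ suc j)          ≡⟨ nth-mirror N xs (subst (j <_) (sym lx) j<m) ⟨
        nth (mirror N xs) j                     ∎
        where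
          open ≡-Reasoning
          j<m : j < m
          j<m = subst (j <_) ly j<
          i = m ∸ suc j
          i<m : i < m
          i<m = ∸-suc-< j<m

  middle≡replicate : ∀ xs cs → length xs ≡ m → length cs ≡ d → All (_≤ N) xs →
    sum (xs ++ (cs ++ mirror N xs)) ≡ n C 2 → cs ≡ replicate d m
  middle≡replicate xs cs lx lc xs≤N sum≡ =
    subst (λ l → cs ≡ replicate l m) lc (≡-replicate cs (subst (_≤ 1) (sym lc) d≤1) sum-cs)
    where
      sum-cs : sum cs ≡ length cs * m
      sum-cs = trans (+-cancelʳ-≡ (m * N) _ _ (trans (sym (sum-layout xs cs lx xs≤N)) (trans sum≡ nC2≡))) (cong (_* m) (sym lc))

  double-half : ∀ v → IsScoreSequence v → SelfComplementary v → double (half v) ≡ v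
  double-half v (v↑ , _ , sum≡) sc with Vec.splitAt m v
  ... | a , cb , refl with Vec.splitAt d cb
  ... | c , b , refl = sym (cong (a Vec.++_) (cong₂ Vec._++_ c≡ b≡))
    where
      La = toList a
      Lc = toList c
      Lb = toList b
      la = Vec.length-toList a
      toList-v : toList v ≡ La ++ (Lc ++ Lb)
      toList-v = trans (Vec.toList-++ a _) (cong (La ++_) (Vec.toList-++ c b))
      a≤N : All (_≤ N) La
      a≤N = All-≤K⇒≤N (subst (λ x → All (_≤ K) (toList x)) (take-++ a _) (half-≤K _ v↑ sc))
      Lb≡ : Lb ≡ mirror N La
      Lb≡ = suffix≡mirror La Lc Lb la (Vec.length-toList c) (Vec.length-toList b) λ {i} i<m → begin
        nth (La ++ (Lc ++ Lb)) (n ∸ suc i)    ≡⟨ cong (λ l → nth l (n ∸ suc i)) toList-v ⟨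
        nth (toList v) (n ∸ suc i)            ≡⟨ selfComplementary⁻ v sc (subst (i <_) (sym n/2≡m) i<m) ⟩
        (n ∸ 1) ∸ nth (toList v) i            ≡⟨ cong₂ (λ x l → x ∸ nth l i) n∸1≡N toList-v ⟩
        N ∸ nth (La ++ (Lc ++ Lb)) i          ≡⟨ cong (N ∸_) (nth-++ˡ La (subst (i <_) (sym la) i<m)) ⟩
        N ∸ nth La i                          ∎
        where open ≡-Reasoning
      b≡ : b ≡ Vec.reverse (Vec.map (N ∸_) a)
      b≡ = toList-injective b _ (trans Lb≡ (sym (trans (Vec.toList-reverse (Vec.map (N ∸_) a)) (cong reverse (Vec.toList-map (N ∸_) a)))))
      c≡ : c ≡ Vec.replicate d m
      c≡ = toList-injective c _ (trans (middle≡replicate La Lc la (Vec.length-toList c) a≤N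
             (trans (cong (λ l → sum (La ++ (Lc ++ l))) (sym Lb≡)) (trans (cong sum (sym toList-v)) sum≡)))
             (sym (Vec.toList-replicate d m)))

  SCS≡count-satisfiesLandau : SCS n ≡ count satisfiesLandau? (vecsUpTo m K)
  SCS≡count-satisfiesLandau = count-bijection (λ v → isScoreSequence? v ×-dec selfComplementary? v) satisfiesLandau? half double
    (vecsUpTo-unique n (n C 2)) (vecsUpTo-unique m K)
    (λ {v} _ (score , sc) → ∈-vecsUpTo⁺ (half v) (half-≤K v (proj₁ score) sc) , half-satisfiesLandau v score , double-half v score sc)
    (λ {a} a∈ landau → let a≤K = ∈-vecsUpTo⁻ a a∈ ; score = double-isScoreSequence a landau a≤K in
      ∈-vecsUpTo⁺ (double a) (subst (λ t → All (_≤ t) (toList (double a))) (proj₂ (proj₂ score)) (All-≤-sum _)) ,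
      (score , double-selfComplementary a) , half-double a)

SCS≡ΣΣF : ∀ k d (d≤1 : d ≤ 1) {K} → k + d ≡ K →
  SCS (Halves.n k d d≤1) ≡ Σ[ suc k C 2 to suc k * K ] (λ T → Σ[ ⌈ T / suc k ⌉ to K ] (λ E → F (suc k) T E))
SCS≡ΣΣF k d d≤1 refl = trans (Halves.SCS≡count-satisfiesLandau k d d≤1) (sym (ΣΣF≡count-satisfiesLandau k (k + d)))

theorem6 : (m : ℕ) → 1 ≤ m →
    (SCS (2 * m) ≡ Σ[ m C 2 to m * (m ∸ 1) ] (λ T → Σ[ ⌈ T / m ⌉ to m ∸ 1 ] (λ E → F m T E)))
    × (SCS (2 * m + 1) ≡ Σ[ m C 2 to m * m ] (λ T → Σ[ ⌈ T / m ⌉ to m ] (λ E → F m T E)))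
theorem6 (suc k) _ =
    trans (cong SCS (even-length k)) (SCS≡ΣΣF k 0 z≤n (+-identityʳ k))
  , trans (cong SCS (odd-length k)) (SCS≡ΣΣF k 1 (s≤s z≤n) (+-comm k 1))
  where
    even-length : ∀ k → 2 * suc k ≡ suc k + (0 + suc k)
    even-length = solve-∀
    odd-length : ∀ k → 2 * suc k + 1 ≡ suc k + (1 + suc k)
    odd-length = solve-∀
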